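{- For every integer $n\ge 1$, the double triangular snake $DT_n$ is a difference graph.
   Context: A graph $G=(V,E)$ is a difference graph if there is a bijection $f$ from $V$ onto a set $S$ of positive integers such that for all distinct $x,y\in V$: $xy\in E$ if and only if $|f(x)-f(y)|\in S$. The double triangular snake $DT_n$ has vertices $u_1,\dots,u_{n+1},v_1,\dots,v_n,w_1,\dots,w_n$ and edges $u_iu_{i+1}$, $v_iu_i$, $v_iu_{i+1}$, $w_iu_i$, $w_iu_{i+1}$ for $1\le i\le n$; i.e. two triangular snakes sharing the common path $u_1u_2\cdots u_{n+1}$. -}

module Defs where

open import Data.Nat using (ℕ; suc; _<_; ∣_-_∣)
open import Data.Fin using (Fin; inject₁) renaming (suc to fsuc)
open import Data.Product using (_×_; ∃)
open import Data.Sum using (_⊎_)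
open import Relation.Nullary using (¬_)
open import Relation.Binary.PropositionalEquality using (_≡_)
open import Function.Bundles using (_⇔_)

record Graph (V : Set) : Set₁ where
  field
    Adj : V → V → Set

-- Vertices of the double triangular snake DT_n (0-indexed):
--   u i, i ∈ {0..n}   (paper: u_1 .. u_{n+1})
--   v i, w i, i ∈ {0..n-1} (paper: v_1..v_n, w_1..w_n)
data DTVertex (n : ℕ) : Set where
  u : Fin (suc n) → DTVertex n
  v : Fin n → DTVertex n
  w : Fin n → DTVertex n

data DTEdge (n : ℕ) : DTVertex n → DTVertex n → Set where
  uu  : (i : Fin n) → DTEdge n (u (inject₁ i)) (u (fsuc i))
  vu₁ : (i : Fin n) → DTEdge n (v i) (u (inject₁ i))
  vu₂ : (i : Fin n) → DTEdge n (v i) (u (fsuc i))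
  wu₁ : (i : Fin n) → DTEdge n (w i) (u (inject₁ i))
  wu₂ : (i : Fin n) → DTEdge n (w i) (u (fsuc i))

DT : (n : ℕ) → Graph (DTVertex n)
DT n = record { Adj = λ x y → DTEdge n x y ⊎ DTEdge n y x }

-- G is a difference graph: there is a bijection f from V onto a set S of
-- positive integers (S is taken to be the image of the injective map f), such
-- that for all distinct x, y:  xy ∈ E  iff  |f x - f y| ∈ S.
IsDifferenceGraph : {V : Set} → Graph V → Set
IsDifferenceGraph {V} G =
  ∃ λ (f : V → ℕ) →
    (∀ x → 0 < f x) ×
    (∀ x y → f x ≡ f y → x ≡ y) ×
    (∀ x y → ¬ x ≡ y →
      (Graph.Adj G x y ⇔ ∃ λ z → f z ≡ ∣ f x - f y ∣))

module Submission where

-- Label v_i, u_i, w_i by c · 2^(n-i) · 3^i with c = 1, 2, 5. Then u_{i+1} carries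
-- 3 · 2^(n-i) · 3^i, so the ends of an edge at position i are two of v_i, u_i, u_{i+1}, w_i,
-- whose labels are 1, 2, 3, 5 times the common scale 2^(n-i) · 3^i, and the difference of
-- the two coefficients is again one of 1, 2, 3.  Conversely, if label x = label y + label z,
-- the 3-adic valuations (the indices) attain their minimum twice, and comparing 2-adic
-- valuations shows that a strictly larger index belongs to a path vertex one step further.
-- So the three labels are a, b, c times one scale with a, b, c ∈ {1, 2, 3, 5}, and the
-- solutions of a = b + c (1 + 1, 1 + 2, 2 + 1, 2 + 3, 3 + 2) are exactly the edges.

open import Data.Empty using (⊥-elim)
open import Data.Fin using (Fin; toℕ; inject₁) renaming (suc to fsuc)
open import Data.Fin.Properties using (toℕ-injective; toℕ-inject₁; toℕ<n)
open import Data.Nat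
open import Data.Nat.Divisibility
open import Data.Nat.Primality using (Prime; prime?; prime[2]; euclidsLemma; prime⇒nonTrivial)
open import Data.Nat.Properties
open import Data.Nat.Tactic.RingSolver using (solve-∀)
open import Data.Product using (∃; _×_; _,_)
open import Data.Sum using (inj₁; inj₂; swap)
open import Function.Bundles using (mk⇔)
open import Relation.Binary.Definitions using (tri<; tri≈; tri>)
open import Relation.Binary.PropositionalEquality
open import Relation.Nullary using (¬_)
open import Relation.Nullary.Decidable using (toWitness; toWitnessFalse)

open import Defs

private
  variable
    a b c d e m n p x y z M : ℕ

record ExactPower (p e x : ℕ) : Set where
  constructor exactPower
  field
    cofactor   : ℕ
    p∤cofactor : ¬ p ∣ cofactor
    decompose  : x ≡ p ^ e * cofactor

NoUniqueMinimum : ℕ → ℕ → ℕ → Set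
NoUniqueMinimum a b c = ¬ (a < b × a < c) × ¬ (b < a × b < c) × ¬ (c < a × c < b)

data MinimumPattern (a b c : ℕ) : Set where
  all-equal  : a ≡ b → a ≡ c → MinimumPattern a b c
  ab-below-c : a ≡ b → a < c → MinimumPattern a b c
  ac-below-b : a ≡ c → a < b → MinimumPattern a b c
  bc-below-a : b ≡ c → b < a → MinimumPattern a b c

minimumPattern : NoUniqueMinimum a b c → MinimumPattern a b c
minimumPattern {a} {b} {c} (¬a , ¬b , ¬c) with <-cmp a b | <-cmp a c | <-cmp b c
... | tri≈ _ a≡b _ | tri≈ _ a≡c _ | _            = all-equal a≡b a≡c
... | tri≈ _ a≡b _ | tri< a<c _ _ | _            = ab-below-c a≡b a<c
... | tri≈ _ a≡b _ | tri> _ _ c<a | _            = ⊥-elim (¬c (c<a , subst (c <_) a≡b c<a))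
... | tri< a<b _ _ | tri< a<c _ _ | _            = ⊥-elim (¬a (a<b , a<c))
... | tri< a<b _ _ | tri≈ _ a≡c _ | _            = ac-below-b a≡c a<b
... | tri< a<b _ _ | tri> _ _ c<a | _            = ⊥-elim (¬c (c<a , <-trans c<a a<b))
... | tri> _ _ b<a | _            | tri< b<c _ _ = ⊥-elim (¬b (b<a , b<c))
... | tri> _ _ b<a | _            | tri≈ _ b≡c _ = bc-below-a b≡c b<a
... | tri> _ _ b<a | _            | tri> _ _ c<b = ⊥-elim (¬c (<-trans c<b b<a , c<b))

^-monoʳ-∣ : ∀ p → a ≤ b → p ^ a ∣ p ^ b
^-monoʳ-∣ {a} {b} p a≤b = divides (p ^ (b ∸ a)) (begin
  p ^ b               ≡⟨ cong (p ^_) (m+[n∸m]≡n a≤b) ⟨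
  p ^ (a + (b ∸ a))   ≡⟨ ^-distribˡ-+-* p a (b ∸ a) ⟩
  p ^ a * p ^ (b ∸ a) ≡⟨ *-comm (p ^ a) _ ⟩
  p ^ (b ∸ a) * p ^ a ∎)
  where open ≡-Reasoning

module _ {p : ℕ} .{{_ : NonZero p}} where

  exactPower-∣ : ExactPower p e x → d ≤ e → p ^ d ∣ x
  exactPower-∣ {e} (exactPower q _ refl) d≤e = ∣-trans (^-monoʳ-∣ p d≤e) (m∣m*n q)

  exactPower-∤ : ExactPower p e x → ¬ p ^ suc e ∣ x
  exactPower-∤ {e} (exactPower q p∤q refl) p^[1+e]∣x =
    p∤q (*-cancelˡ-∣ (p ^ e) {{m^n≢0 p e}} (subst (_∣ p ^ e * q) (*-comm p (p ^ e)) p^[1+e]∣x))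

  exactPower-unique : ExactPower p a x → ExactPower p b x → a ≡ b
  exactPower-unique {a = a} {b = b} pa pb with <-cmp a b
  ... | tri< a<b _ _ = ⊥-elim (exactPower-∤ pa (exactPower-∣ pb a<b))
  ... | tri≈ _ a≡b _ = a≡b
  ... | tri> _ _ b<a = ⊥-elim (exactPower-∤ pb (exactPower-∣ pa b<a))

  exactPower-sum : ExactPower p a x → ExactPower p b y → ExactPower p c z → x ≡ y + z →
                   NoUniqueMinimum a b c
  exactPower-sum {b = b} {y = y} {z = z} pa pb pc refl =
      (λ (a<b , a<c) → exactPower-∤ pa (∣m∣n⇒∣m+n (exactPower-∣ pb a<b) (exactPower-∣ pc a<c)))
    , (λ (b<a , b<c) → exactPower-∤ pb
          (∣m+n∣m⇒∣n (subst (p ^ suc b ∣_) (+-comm y z) (exactPower-∣ pa b<a)) (exactPower-∣ pc b<c)))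
    , (λ (c<a , c<b) → exactPower-∤ pc (∣m+n∣m⇒∣n (exactPower-∣ pa c<a) (exactPower-∣ pb c<b)))

module _ (prime : Prime p) where

  prime∤* : ¬ p ∣ a → ¬ p ∣ b → ¬ p ∣ a * b
  prime∤* {a} {b} p∤a p∤b p∣ab with euclidsLemma a b prime p∣ab
  ... | inj₁ p∣a = p∤a p∣a
  ... | inj₂ p∣b = p∤b p∣b

  prime∤^ : ∀ e → ¬ p ∣ a → ¬ p ∣ a ^ e
  prime∤^ zero    _   p∣1 = nonTrivial⇒≢1 {{prime⇒nonTrivial prime}} (∣1⇒≡1 p∣1)
  prime∤^ (suc e) p∤a     = prime∤* p∤a (prime∤^ e p∤a)

prime[3] : Prime 3
prime[3] = toWitness {a? = prime? 3} _

toℕ≡⇒inject₁ : ∀ {k} (i : Fin (suc k)) (j : Fin k) → toℕ i ≡ toℕ j → i ≡ inject₁ j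
toℕ≡⇒inject₁ i j i≡j = toℕ-injective (trans i≡j (sym (toℕ-inject₁ j)))

adjacent-indices : m < M → M ≤ n → d ≤ 1 → n ∸ m ≤ d + (n ∸ M) → d ≡ 1 × M ≡ suc m
adjacent-indices {d = zero} m<M M≤n _ n∸m≤n∸M = ⊥-elim (<⇒≱ (∸-monoʳ-< m<M M≤n) n∸m≤n∸M)
adjacent-indices {m} {M} {n} {suc zero} m<M M≤n _ n∸m≤1+n∸M =
  refl , ≤-antisym (≮⇒≥ λ 1+m<M → <⇒≱ (far 1+m<M) n∸m≤1+n∸M) m<M
  where
  far : suc m < M → suc (n ∸ M) < n ∸ m
  far 1+m<M = ≤-<-trans (∸-monoʳ-< 1+m<M M≤n) (∸-monoʳ-< (n<1+n m) (<⇒≤ (<-≤-trans 1+m<M M≤n)))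
adjacent-indices {d = suc (suc _)} _ _ (s≤s ()) _

m≡n+∣m-n∣ : n ≤ m → m ≡ n + ∣ m - n ∣
m≡n+∣m-n∣ {n} {m} n≤m = trans (sym (m+[n∸m]≡n n≤m)) (cong (n +_) (sym (m≤n⇒∣n-m∣≡n∸m n≤m)))

module Labelling (n : ℕ) where

  open Graph (DT n) using (Adj)

  scale : ℕ → ℕ
  scale i = 2 ^ (n ∸ i) * 3 ^ i

  scale-nonZero : ∀ i → NonZero (scale i)
  scale-nonZero i = m*n≢0 (2 ^ (n ∸ i)) (3 ^ i) {{m^n≢0 2 (n ∸ i)}} {{m^n≢0 3 i}}

  scale-suc : m < n → 2 * scale (suc m) ≡ 3 * scale m
  scale-suc {m} m<n = begin
    2 * (2 ^ (n ∸ suc m) * 3 ^ suc m) ≡⟨ regroup (2 ^ (n ∸ suc m)) (3 ^ m) ⟩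
    3 * (2 ^ suc (n ∸ suc m) * 3 ^ m) ≡⟨ cong (λ k → 3 * (2 ^ k * 3 ^ m)) (+-∸-assoc 1 m<n) ⟨
    3 * (2 ^ (n ∸ m) * 3 ^ m)         ∎
    where
    open ≡-Reasoning
    regroup : ∀ s t → 2 * (s * (3 * t)) ≡ 3 * ((2 * s) * t)
    regroup = solve-∀

  twos oddPart coefficient index : DTVertex n → ℕ
  twos (u _) = 1
  twos (v _) = 0
  twos (w _) = 0

  oddPart (u _) = 1
  oddPart (v _) = 1
  oddPart (w _) = 5

  coefficient x = 2 ^ twos x * oddPart x

  index (u i) = toℕ i
  index (v i) = toℕ i
  index (w i) = toℕ i

  label : DTVertex n → ℕ
  label x = coefficient x * scale (index x)

  index≤n : ∀ x → index x ≤ n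
  index≤n (u i) = ≤-pred (toℕ<n i)
  index≤n (v i) = <⇒≤ (toℕ<n i)
  index≤n (w i) = <⇒≤ (toℕ<n i)

  twos≤1 : ∀ x → twos x ≤ 1
  twos≤1 (u _) = ≤-refl
  twos≤1 (v _) = z≤n
  twos≤1 (w _) = z≤n

  coefficient-nonZero : ∀ x → NonZero (coefficient x)
  coefficient-nonZero (u _) = _
  coefficient-nonZero (v _) = _
  coefficient-nonZero (w _) = _

  3∤oddPart : ∀ x → ¬ 3 ∣ oddPart x
  3∤oddPart (u _) = toWitnessFalse {a? = 3 ∣? 1} _
  3∤oddPart (v _) = toWitnessFalse {a? = 3 ∣? 1} _
  3∤oddPart (w _) = toWitnessFalse {a? = 3 ∣? 5} _

  2∤oddPart : ∀ x → ¬ 2 ∣ oddPart x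
  2∤oddPart (u _) = toWitnessFalse {a? = 2 ∣? 1} _
  2∤oddPart (v _) = toWitnessFalse {a? = 2 ∣? 1} _
  2∤oddPart (w _) = toWitnessFalse {a? = 2 ∣? 5} _

  label-3-adic : ∀ x → ExactPower 3 (index x) (label x)
  label-3-adic x = exactPower (coefficient x * 2 ^ (n ∸ index x))
    (prime∤* prime[3] (prime∤* prime[3] (prime∤^ prime[3] (twos x) 3∤2) (3∤oddPart x))
                      (prime∤^ prime[3] (n ∸ index x) 3∤2))
    (regroup (coefficient x) (2 ^ (n ∸ index x)) (3 ^ index x))
    where
    3∤2 : ¬ 3 ∣ 2
    3∤2 = toWitnessFalse {a? = 3 ∣? 2} _
    regroup : ∀ c s t → c * (s * t) ≡ t * (c * s)
    regroup = solve-∀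

  label-2-adic : ∀ x → ExactPower 2 (twos x + (n ∸ index x)) (label x)
  label-2-adic x = exactPower (oddPart x * 3 ^ index x)
    (prime∤* prime[2] (2∤oddPart x) (prime∤^ prime[2] (index x) 2∤3))
    (begin
      2 ^ t * oddPart x * (2 ^ k * 3 ^ index x) ≡⟨ regroup (2 ^ t) (oddPart x) (2 ^ k) (3 ^ index x) ⟩
      2 ^ t * 2 ^ k * (oddPart x * 3 ^ index x) ≡⟨ cong (_* (oddPart x * 3 ^ index x)) (^-distribˡ-+-* 2 t k) ⟨
      2 ^ (t + k) * (oddPart x * 3 ^ index x)   ∎)
    where
    open ≡-Reasoning
    t = twos x
    k = n ∸ index x
    2∤3 : ¬ 2 ∣ 3
    2∤3 = toWitnessFalse {a? = 2 ∣? 3} _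
    regroup : ∀ r o s t → r * o * (s * t) ≡ r * s * (o * t)
    regroup = solve-∀

  label-positive : ∀ x → 0 < label x
  label-positive x = >-nonZero⁻¹ (label x)
    {{m*n≢0 (coefficient x) (scale (index x)) {{coefficient-nonZero x}} {{scale-nonZero (index x)}}}}

  same-coefficient-and-index : ∀ x y → coefficient x ≡ coefficient y → index x ≡ index y → x ≡ y
  same-coefficient-and-index (u _) (u _) _  i≡j = cong u (toℕ-injective i≡j)
  same-coefficient-and-index (v _) (v _) _  i≡j = cong v (toℕ-injective i≡j)
  same-coefficient-and-index (w _) (w _) _  i≡j = cong w (toℕ-injective i≡j)
  same-coefficient-and-index (u _) (v _) () _
  same-coefficient-and-index (u _) (w _) () _
  same-coefficient-and-index (v _) (u _) () _
  same-coefficient-and-index (v _) (w _) () _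
  same-coefficient-and-index (w _) (u _) () _
  same-coefficient-and-index (w _) (v _) () _

  label-injective : ∀ x y → label x ≡ label y → x ≡ y
  label-injective x y eq = same-coefficient-and-index x y coefficient-eq index-eq
    where
    index-eq : index x ≡ index y
    index-eq = exactPower-unique (label-3-adic x)
      (subst (ExactPower 3 (index y)) (sym eq) (label-3-adic y))
    coefficient-eq : coefficient x ≡ coefficient y
    coefficient-eq = *-cancelʳ-≡ (coefficient x) (coefficient y) (scale (index x))
      {{scale-nonZero (index x)}}
      (trans eq (cong (λ i → coefficient y * scale i) (sym index-eq)))

  data Near : DTVertex n → ℕ → ℕ → Set where
    v-near : (i : Fin n)       → toℕ i ≡ m → Near (v i) m 1
    u-near : (i : Fin (suc n)) → toℕ i ≡ m → Near (u i) m 2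
    u-next : (i : Fin n)       → toℕ i ≡ m → Near (u (fsuc i)) m 3
    w-near : (i : Fin n)       → toℕ i ≡ m → Near (w i) m 5

  near-self : ∀ x → index x ≡ m → Near x m (coefficient x)
  near-self (u i) = u-near i
  near-self (v i) = v-near i
  near-self (w i) = w-near i

  near-label : ∀ {x} → Near x m a → label x ≡ a * scale m
  near-label (v-near i refl) = refl
  near-label (u-near i refl) = refl
  near-label (u-next i refl) = scale-suc (toℕ<n i)
  near-label (w-near i refl) = refl

  near-coefficients : ∀ {x y z} → Near x m a → Near y m b → Near z m c →
                      label x ≡ label y + label z → a ≡ b + c
  near-coefficients {m} {a} {b} {c} {x} {y} {z} nx ny nz eq =
    *-cancelʳ-≡ a (b + c) (scale m) {{scale-nonZero m}} (begin
      a * scale m               ≡⟨ near-label nx ⟨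
      label x                   ≡⟨ eq ⟩
      label y + label z         ≡⟨ cong₂ _+_ (near-label ny) (near-label nz) ⟩
      b * scale m + c * scale m ≡⟨ *-distribʳ-+ (scale m) b c ⟨
      (b + c) * scale m         ∎)
    where open ≡-Reasoning

  near-difference : ∀ {x y z} → Near x m a → Near y m b → Near z m c →
                    c ≡ ∣ a - b ∣ → label z ≡ ∣ label x - label y ∣
  near-difference {m} {a} {b} nx ny nz refl
    rewrite near-label nx | near-label ny | near-label nz = *-distribʳ-∣-∣ (scale m) a b

  near-sum⇒adjacent : ∀ {x y z} → Near y m b → Near z m c → Near x m (b + c) → Adj x y
  near-sum⇒adjacent (v-near j refl) (v-near _ _) (u-near i i≡j)
    with refl ← toℕ≡⇒inject₁ i j i≡j = inj₂ (vu₁ j)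
  near-sum⇒adjacent (v-near j refl) (u-near _ _) (u-next i i≡j)
    with refl ← toℕ-injective i≡j = inj₂ (vu₂ j)
  near-sum⇒adjacent (u-near j refl) (v-near _ _) (u-next i i≡j)
    with refl ← toℕ≡⇒inject₁ j i (sym i≡j) = inj₂ (uu i)
  near-sum⇒adjacent (u-near j refl) (u-next _ _) (w-near i i≡j)
    with refl ← toℕ≡⇒inject₁ j i (sym i≡j) = inj₁ (wu₁ i)
  near-sum⇒adjacent (u-next j refl) (u-near _ _) (w-near i i≡j)
    with refl ← toℕ-injective i≡j = inj₁ (wu₂ i)
  near-sum⇒adjacent (v-near _ _) (w-near _ _) ()
  near-sum⇒adjacent (u-near _ _) (w-near _ _) ()
  near-sum⇒adjacent (u-next _ _) (w-near _ _) ()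
  near-sum⇒adjacent (w-near _ _) (w-near _ _) ()

  twoAdicity : DTVertex n → ℕ
  twoAdicity x = twos x + (n ∸ index x)

  next-near : ∀ h l₁ l₂ → m < index h → index l₁ ≡ m → index l₂ ≡ m →
              ¬ (twoAdicity h < twoAdicity l₁ × twoAdicity h < twoAdicity l₂) → Near h m 3
  next-near {m} h l₁ l₂ m<h l₁≡m l₂≡m not-lowest
    with adjacent-indices m<h (index≤n h) (twos≤1 h) (≮⇒≥ below-both)
    where
    at-least : ∀ l → index l ≡ m → n ∸ m ≤ twoAdicity l
    at-least l refl = m≤n+m (n ∸ index l) (twos l)
    below-both : ¬ twoAdicity h < n ∸ m
    below-both h< = not-lowest (<-≤-trans h< (at-least l₁ l₁≡m) , <-≤-trans h< (at-least l₂ l₂≡m))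
  -- twos h ≡ 1 leaves only the vertices u, and index h ≡ suc m excludes u 0.
  next-near (u (fsuc i)) _ _ _ _ _ _ | _ , 1+i≡1+m = u-next i (suc-injective 1+i≡1+m)

  common-scale⇒adjacent : ∀ {x y z} → Near x m a → Near y m b → Near z m c →
                          label x ≡ label y + label z → Adj x y
  common-scale⇒adjacent nx ny nz eq with refl ← near-coefficients nx ny nz eq =
    near-sum⇒adjacent ny nz nx

  sum⇒adjacent : ∀ x y z → label x ≡ label y + label z → Adj x y
  sum⇒adjacent x y z eq
    with minimumPattern (exactPower-sum (label-3-adic x) (label-3-adic y) (label-3-adic z) eq)
       | exactPower-sum (label-2-adic x) (label-2-adic y) (label-2-adic z) eq
  ... | all-equal x≡y x≡z | _ = common-scale⇒adjacent
    (near-self x refl) (near-self y (sym x≡y)) (near-self z (sym x≡z)) eq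
  ... | ab-below-c x≡y x<z | _ , _ , z-not-lowest = common-scale⇒adjacent
    (near-self x refl) (near-self y (sym x≡y)) (next-near z x y x<z refl (sym x≡y) z-not-lowest) eq
  ... | ac-below-b x≡z x<y | _ , y-not-lowest , _ = common-scale⇒adjacent
    (near-self x refl) (next-near y x z x<y refl (sym x≡z) y-not-lowest) (near-self z (sym x≡z)) eq
  ... | bc-below-a y≡z y<x | x-not-lowest , _ = common-scale⇒adjacent
    (next-near x y z y<x refl (sym y≡z) x-not-lowest) (near-self y refl) (near-self z (sym y≡z)) eq

  difference⇒adjacent : ∀ x y → (∃ λ z → label z ≡ ∣ label x - label y ∣) → Adj x y
  difference⇒adjacent x y (z , eq) with ≤-total (label y) (label x)
  ... | inj₁ y≤x = sum⇒adjacent x y z (trans (m≡n+∣m-n∣ y≤x) (cong (label y +_) (sym eq)))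
  ... | inj₂ x≤y = swap (sum⇒adjacent y x z
    (trans (m≡n+∣m-n∣ x≤y) (cong (label x +_) (trans (∣-∣-comm (label y) (label x)) (sym eq)))))

  edge⇒difference : ∀ {x y} → DTEdge n x y → ∃ λ z → label z ≡ ∣ label x - label y ∣
  edge⇒difference (uu i)  = v i , near-difference
    (u-near (inject₁ i) (toℕ-inject₁ i)) (u-next i refl) (v-near i refl) refl
  edge⇒difference (vu₁ i) = v i , near-difference
    (v-near i refl) (u-near (inject₁ i) (toℕ-inject₁ i)) (v-near i refl) refl
  edge⇒difference (vu₂ i) = u (inject₁ i) , near-difference
    (v-near i refl) (u-next i refl) (u-near (inject₁ i) (toℕ-inject₁ i)) refl
  edge⇒difference (wu₁ i) = u (fsuc i) , near-difference
    (w-near i refl) (u-near (inject₁ i) (toℕ-inject₁ i)) (u-next i refl) refl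
  edge⇒difference (wu₂ i) = u (inject₁ i) , near-difference
    (w-near i refl) (u-next i refl) (u-near (inject₁ i) (toℕ-inject₁ i)) refl

  adjacent⇒difference : ∀ x y → Adj x y → ∃ λ z → label z ≡ ∣ label x - label y ∣
  adjacent⇒difference x y (inj₁ xy) = edge⇒difference xy
  adjacent⇒difference x y (inj₂ yx) with z , eq ← edge⇒difference yx =
    z , trans eq (∣-∣-comm (label y) (label x))

theorem3p6 : (n : ℕ) → n ≥ 1 → IsDifferenceGraph (DT n)
theorem3p6 n _ = label , label-positive , label-injective ,
  λ x y _ → mk⇔ (adjacent⇒difference x y) (difference⇒adjacent x y)
  where open Labelling n
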